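{- Let $n$ be a positive integer, $y_n=\frac{n+\sqrt{n^2+4}}{2}=[n,n,n,\dots]$, and $\langle n\rangle_q=q[n]_q+(1+q^n)(1-q)$. Then (i) $$[y_n]_q=[n]_q+\cfrac{q^{2n}}{\langle n\rangle_q+\cfrac{q^{2n+1}}{\langle n\rangle_q+\cfrac{q^{2n+1}}{\ddots}}}\qquad\text{and}\qquad \sigma_q(y_n)=\cfrac{q^{n-1}}{\langle n\rangle_q+\cfrac{q^{2n+1}}{\langle n\rangle_q+\cfrac{q^{2n+1}}{\ddots}}},$$ where $\sigma_q(y_n)=\frac{[y_n]_q-[n]_q}{q^{n+1}}$; (ii) the second continued fraction in (i) is a super $\delta$-fraction with $\delta=3$.
   Context: For $a\in\mathbb{Z}$ put $[a]_q=\frac{1-q^a}{1-q}$ and $[a]_{q^{ -1}}=q^{1-a}[a]_q$. For irrational $x=[a_1,a_2,\dots]$ (regular continued fraction, $a_1\in\mathbb{Z}$, $a_i\ge1$ for $i\ge2$), its $q$-deformation is $[x]_q=[a_1]_q+\cfrac{q^{a_1}}{[a_2]_{q^{ -1}}+\cfrac{q^{ -a_2}}{[a_3]_q+\cfrac{q^{a_3}}{[a_4]_{q^{ -1}}+\ddots}}}$, the limit of the finite truncations (whose coefficients stabilize); for $x=y_n$ this is a formal power series and $\sigma_q(y_n)$ is again a formal power series. Infinite continued fractions denote $q$-adic limits of their truncations. For a positive integer $\delta$, a super $\delta$-fraction is a continued fraction of the form $$\cfrac{v_0q^{k_0}}{1+qU_1(q)-\cfrac{v_1q^{k_0+k_1+\delta}}{1+qU_2(q)-\cfrac{v_2q^{k_1+k_2+\delta}}{1+qU_3(q)-\ddots}}}$$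 with nonzero constants $v_i$, integers $k_i\ge0$, and polynomials $U_i$ with $\deg U_i\le k_{i-1}+\delta-2$. -}

module Defs where

open import Data.Nat as ℕ using (ℕ; zero; suc; _<_; _≤_; _∸_; _<ᵇ_; _≡ᵇ_)
open import Data.Integer using (ℤ; 0ℤ; 1ℤ; -_) renaming (_+_ to _+ℤ_; _*_ to _*ℤ_)
open import Data.Bool using (Bool; true; false; if_then_else_; not)
open import Data.Product using (Σ; _×_; _,_; proj₁; proj₂; ∃-syntax)
open import Relation.Binary.PropositionalEquality using (_≡_)
open import Relation.Nullary using (¬_)

-- Formal power series over ℤ in q, as coefficient functions.
-- Polynomials are series with finite support.

Series : Set
Series = ℕ → ℤ

_≈_ : Series → Series → Set
f ≈ g = ∀ j → f j ≡ g j

cst : ℤ → Series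
cst c zero    = c
cst c (suc _) = 0ℤ

qpow : ℕ → Series
qpow k j = if j ≡ᵇ k then 1ℤ else 0ℤ

infixl 6 _⊕_
infixl 7 _⊛_
infix 8 ⊖_
infix 4 _≈_

_⊕_ : Series → Series → Series
(f ⊕ g) j = f j +ℤ g j

⊖_ : Series → Series
(⊖ f) j = - f j

sumTo : (ℕ → ℤ) → ℕ → ℤ
sumTo h zero    = h zero
sumTo h (suc n) = sumTo h n +ℤ h (suc n)

_⊛_ : Series → Series → Series
(f ⊛ g) n = sumTo (λ i → f i *ℤ g (n ∸ i)) n

qint : ℕ → Series
qint a j = if j <ᵇ a then 1ℤ else 0ℤ

angle : ℕ → Series
angle n = qpow 1 ⊛ qint n ⊕ (cst 1ℤ ⊕ qpow n) ⊛ (cst 1ℤ ⊕ ⊖ qpow 1)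

-- Formal fractions P/Q of series (used for finite truncations, which are
-- rational functions in q, possibly involving negative powers of q).

Frac : Set
Frac = Series × Series

embed : Series → Frac
embed f = f , cst 1ℤ

infixl 6 _+F_
infixl 7 _/F_

_+F_ : Frac → Frac → Frac
(p , q) +F (r , s) = (p ⊛ s ⊕ r ⊛ q) , q ⊛ s

_/F_ : Frac → Frac → Frac
(p , q) /F (r , s) = (p ⊛ s) , (q ⊛ r)

-- q-adic convergence of a sequence of fractions f m = P_m/Q_m to a power
-- series g: for every N, eventually Q_m ≠ 0 and P_m/Q_m ≡ g mod q^N,
-- i.e. with d = ord_q(Q_m), P_m - Q_m g ≡ 0 mod q^(N+d).

Converges : (ℕ → Frac) → Series → Set
Converges f g =
  ∀ N → ∃[ M ] ∀ m → M ≤ m → ∃[ d ]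
    ( (∀ j → j < d → proj₂ (f m) j ≡ 0ℤ)
    × ¬ (proj₂ (f m) d ≡ 0ℤ)
    × (∀ j → j < N ℕ.+ d → (proj₁ (f m) ⊕ ⊖ (proj₂ (f m) ⊛ g)) j ≡ 0ℤ))

-- q-deformed regular continued fraction [a_1, a_2, …]_q with all a_i ∈ ℕ
-- (a i = a_{i+1}); the Bool records the level: true = q, false = q^{-1}.
--   [a]_{q^{-1}} = q^{1-a}[a]_q = [a]_q / q^{a-1}    (a ≥ 1)
--   q^{-a}       = 1 / q^a

qbr : Bool → ℕ → Frac
qbr true  a = qint a , cst 1ℤ
qbr false a = qint a , qpow (a ∸ 1)

qnum : Bool → ℕ → Frac
qnum true  a = qpow a , cst 1ℤ
qnum false a = cst 1ℤ , qpow a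

qcfFrom : Bool → (ℕ → ℕ) → ℕ → ℕ → Frac
qcfFrom p a i zero    = qbr p (a i)
qcfFrom p a i (suc m) = qbr p (a i) +F (qnum p (a i) /F qcfFrom (not p) a (suc i) m)

-- m-th truncation [a_1, …, a_{m+1}]_q
qcfTrunc : (ℕ → ℕ) → ℕ → Frac
qcfTrunc a m = qcfFrom true a zero m

-- Generalised continued fraction  a_0/(b_1 + a_1/(b_2 + a_2/(b_3 + …)))
-- (the value of b at index 0 is unused).

record GCF : Set where
  field
    num : ℕ → Series
    den : ℕ → Series

open GCF public

gcfInner : GCF → ℕ → ℕ → Frac
gcfInner c i zero    = embed (den c i)
gcfInner c i (suc m) = embed (den c i) +F (embed (num c i) /F gcfInner c (suc i) m)

-- m-th truncation a_0/(b_1 + … + a_m/b_{m+1})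
gcfTrunc : GCF → ℕ → Frac
gcfTrunc c m = embed (num c zero) /F gcfInner c 1 m

-- super δ-fraction:
--   v_0 q^{k_0}/(1+qU_1 - v_1 q^{k_0+k_1+δ}/(1+qU_2 - v_2 q^{k_1+k_2+δ}/(…)))
-- with v_i ≠ 0, k_i ≥ 0, deg U_i ≤ k_{i-1}+δ-2 (U_i polynomials).
IsSuperFraction : ℕ → GCF → Set
IsSuperFraction δ c =
  Σ (ℕ → ℤ) λ v → Σ (ℕ → ℕ) λ k → Σ (ℕ → Series) λ U →
    ( (∀ i → ¬ (v i ≡ 0ℤ))
    × (num c zero ≈ cst (v zero) ⊛ qpow (k zero))
    × (∀ i → num c (suc i) ≈ ⊖ (cst (v (suc i)) ⊛ qpow (k i ℕ.+ k (suc i) ℕ.+ δ)))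
    × (∀ i → den c (suc i) ≈ cst 1ℤ ⊕ qpow 1 ⊛ U (suc i))
    × (∀ i j → k i ℕ.+ δ < j ℕ.+ 2 → U (suc i) j ≡ 0ℤ))

cfY : ℕ → GCF
cfY n = record { num = λ { zero → qpow (n ℕ.+ n) ; (suc _) → qpow (suc (n ℕ.+ n)) }
               ; den = λ _ → angle n }

cfSigma : ℕ → GCF
cfSigma n = record { num = λ { zero → qpow (n ∸ 1) ; (suc _) → qpow (suc (n ℕ.+ n)) }
                   ; den = λ _ → angle n }

{-# OPTIONS --safe #-}
-- σ = σ_q(y_n) is the root of A σ + q^(n+2) σ² = q^(n-1), A = ⟨n⟩_q, obtained as the fixed point of
-- a q-adic contraction (A ≡ 1 mod q). If u/v is a truncation of ⟨n⟩ + q^(2n+1)/(⟨n⟩ + …), the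
-- error q^(n-1) v - u σ is multiplied by -q^(n+2) σ at each further level, so the σ-fraction
-- converges to σ and [n]_q + q^(2n)/(⟨n⟩ + …) to y = [n]_q + q^(n+1) σ. Since [n]_q (1 - q) = 1 - q^n,
-- this y is also the fixed point of the map by which two levels of the regular q-continued fraction
-- [n, n, …]_q act on (numerator, denominator); once the common power of q is removed, two levels
-- multiply the error by q. Part (ii) is read off: the partial numerators are q^(n-1) and q^(2n+1),
-- and ⟨n⟩ = 1 + q U with deg U ≤ n.
module Submission where

open import Defs
open import Data.Nat using (ℕ; zero; suc; _+_; _<_; _≤_; _∸_; z≤n; s≤s; z<s; ⌊_/2⌋)
import Data.Nat.Properties as ℕP
open import Data.Integer as ℤ using (ℤ; 0ℤ; 1ℤ; -_; +-*-rawRing)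
  renaming (_+_ to _+ℤ_; _*_ to _*ℤ_)
import Data.Integer.Properties as ℤP
open import Data.Integer.Tactic.RingSolver using (solve-∀)
open import Data.Product using (_×_; _,_; proj₁; proj₂; ∃-syntax)
open import Data.Bool using (true)
open import Data.Maybe using (Maybe; just; nothing)
open import Function using (_∘_)
open import Relation.Nullary using (¬_; yes; no)
open import Relation.Binary.PropositionalEquality
  using (_≡_; refl; sym; trans; cong; cong₂; cong-app; subst; _→-setoid_; module ≡-Reasoning)
open import Level using (0ℓ)
open import Algebra.Bundles using (CommutativeRing)
open import Algebra.Structures {A = Series} _≈_ using (IsCommutativeRing)
open import Algebra.Properties.CommutativeSemigroup ℤP.+-commutativeSemigroup using (interchange)
import Algebra.Construct.Pointwise ℕ as Pointwise
import Algebra.Consequences.Setoid (ℕ →-setoid ℤ) as Consequences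
open import Algebra.Solver.Ring.AlmostCommutativeRing
  using (fromCommutativeRing; _-Raw-AlmostCommutative⟶_)
import Algebra.Solver.Ring as RingSolver
import Relation.Binary.Reasoning.Setoid as SetoidReasoning

-- The ring of formal power series

sumTo-cong : ∀ {h h′} n → (∀ i → i ≤ n → h i ≡ h′ i) → sumTo h n ≡ sumTo h′ n
sumTo-cong zero    h≡h′ = h≡h′ zero z≤n
sumTo-cong (suc n) h≡h′ =
  cong₂ _+ℤ_ (sumTo-cong n (λ i i≤n → h≡h′ i (ℕP.m≤n⇒m≤1+n i≤n))) (h≡h′ (suc n) ℕP.≤-refl)

sumTo-zero : ∀ {h} n → (∀ i → i ≤ n → h i ≡ 0ℤ) → sumTo h n ≡ 0ℤ
sumTo-zero zero    h≡0 = h≡0 zero z≤n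
sumTo-zero (suc n) h≡0 =
  cong₂ _+ℤ_ (sumTo-zero n (λ i i≤n → h≡0 i (ℕP.m≤n⇒m≤1+n i≤n))) (h≡0 (suc n) ℕP.≤-refl)

sumTo-+ : ∀ h h′ n → sumTo (λ i → h i +ℤ h′ i) n ≡ sumTo h n +ℤ sumTo h′ n
sumTo-+ h h′ zero    = refl
sumTo-+ h h′ (suc n) =
  trans (cong (_+ℤ (h (suc n) +ℤ h′ (suc n))) (sumTo-+ h h′ n))
        (interchange (sumTo h n) (sumTo h′ n) (h (suc n)) (h′ (suc n)))

*-sumTo : ∀ c h n → c *ℤ sumTo h n ≡ sumTo (λ i → c *ℤ h i) n
*-sumTo c h zero    = refl
*-sumTo c h (suc n) =
  trans (ℤP.*-distribˡ-+ c (sumTo h n) (h (suc n))) (cong (_+ℤ c *ℤ h (suc n)) (*-sumTo c h n))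

sumTo-suc : ∀ h n → sumTo h (suc n) ≡ h 0 +ℤ sumTo (λ i → h (suc i)) n
sumTo-suc h zero    = refl
sumTo-suc h (suc n) =
  trans (cong (_+ℤ h (suc (suc n))) (sumTo-suc h n)) (ℤP.+-assoc (h 0) _ _)

sumTo-reverse : ∀ h n → sumTo h n ≡ sumTo (λ i → h (n ∸ i)) n
sumTo-reverse h zero    = refl
sumTo-reverse h (suc n) = begin
  sumTo h n +ℤ h (suc n)                  ≡⟨ cong (_+ℤ h (suc n)) (sumTo-reverse h n) ⟩
  sumTo (λ i → h (n ∸ i)) n +ℤ h (suc n)  ≡⟨ ℤP.+-comm _ (h (suc n)) ⟩
  h (suc n) +ℤ sumTo (λ i → h (n ∸ i)) n  ≡⟨ sym (sumTo-suc (λ i → h (suc n ∸ i)) n) ⟩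
  sumTo (λ i → h (suc n ∸ i)) (suc n)     ∎
  where open ≡-Reasoning

tail : Series → Series
tail f j = f (suc j)

infixr 8 _•_

_•_ : ℤ → Series → Series
(c • f) j = c *ℤ f j

⊛-suc : ∀ f g j → (f ⊛ g) (suc j) ≡ f 0 *ℤ g (suc j) +ℤ (tail f ⊛ g) j
⊛-suc f g j = sumTo-suc (λ i → f i *ℤ g (suc j ∸ i)) j

⊕-cong : ∀ {f f′ g g′} → f ≈ f′ → g ≈ g′ → f ⊕ g ≈ f′ ⊕ g′
⊕-cong f≈f′ g≈g′ j = cong₂ _+ℤ_ (f≈f′ j) (g≈g′ j)

⊛-cong : ∀ {f f′ g g′} → f ≈ f′ → g ≈ g′ → f ⊛ g ≈ f′ ⊛ g′
⊛-cong f≈f′ g≈g′ j = sumTo-cong j (λ i _ → cong₂ _*ℤ_ (f≈f′ i) (g≈g′ (j ∸ i)))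

⊕-congˡ : ∀ f {g g′} → g ≈ g′ → f ⊕ g ≈ f ⊕ g′
⊕-congˡ f = ⊕-cong (λ i → refl {x = f i})

⊕-congʳ : ∀ g {f f′} → f ≈ f′ → f ⊕ g ≈ f′ ⊕ g
⊕-congʳ g f≈f′ = ⊕-cong f≈f′ (λ i → refl {x = g i})

⊛-congˡ : ∀ f {g g′} → g ≈ g′ → f ⊛ g ≈ f ⊛ g′
⊛-congˡ f = ⊛-cong (λ i → refl {x = f i})

⊛-congʳ : ∀ g {f f′} → f ≈ f′ → f ⊛ g ≈ f′ ⊛ g
⊛-congʳ g f≈f′ = ⊛-cong f≈f′ (λ i → refl {x = g i})

⊛-comm : ∀ f g → f ⊛ g ≈ g ⊛ f
⊛-comm f g j = trans (sumTo-reverse _ j) (sumTo-cong j λ i i≤j →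
  trans (cong (λ k → f (j ∸ i) *ℤ g k) (ℕP.m∸[m∸n]≡n i≤j)) (ℤP.*-comm (f (j ∸ i)) (g i)))

⊛-distribˡ-⊕ : ∀ f g h → f ⊛ (g ⊕ h) ≈ f ⊛ g ⊕ f ⊛ h
⊛-distribˡ-⊕ f g h j =
  trans (sumTo-cong j (λ i _ → ℤP.*-distribˡ-+ (f i) (g (j ∸ i)) (h (j ∸ i)))) (sumTo-+ _ _ j)

⊛-distribʳ-⊕ : ∀ f g h → (g ⊕ h) ⊛ f ≈ g ⊛ f ⊕ h ⊛ f
⊛-distribʳ-⊕ = Consequences.comm∧distrˡ⇒distrʳ ⊕-cong ⊛-comm ⊛-distribˡ-⊕

•-⊛ : ∀ c f g j → ((c • f) ⊛ g) j ≡ c *ℤ (f ⊛ g) j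
•-⊛ c f g j = trans (sumTo-cong j (λ i _ → ℤP.*-assoc c (f i) _)) (sym (*-sumTo c _ j))

⊛-assoc : ∀ f g h → (f ⊛ g) ⊛ h ≈ f ⊛ (g ⊛ h)
⊛-assoc f g h zero    = ℤP.*-assoc (f 0) (g 0) (h 0)
⊛-assoc f g h (suc j) = begin
  ((f ⊛ g) ⊛ h) (suc j)
    ≡⟨ ⊛-suc (f ⊛ g) h j ⟩
  f 0 *ℤ g 0 *ℤ h (suc j) +ℤ (tail (f ⊛ g) ⊛ h) j
    ≡⟨ cong (f 0 *ℤ g 0 *ℤ h (suc j) +ℤ_) (⊛-cong (⊛-suc f g) (λ i → refl {x = h i}) j) ⟩
  f 0 *ℤ g 0 *ℤ h (suc j) +ℤ ((f 0 • tail g ⊕ tail f ⊛ g) ⊛ h) j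
    ≡⟨ cong (f 0 *ℤ g 0 *ℤ h (suc j) +ℤ_) (⊛-distribʳ-⊕ h (f 0 • tail g) (tail f ⊛ g) j) ⟩
  f 0 *ℤ g 0 *ℤ h (suc j) +ℤ (((f 0 • tail g) ⊛ h) j +ℤ ((tail f ⊛ g) ⊛ h) j)
    ≡⟨ cong₂ (λ a b → f 0 *ℤ g 0 *ℤ h (suc j) +ℤ (a +ℤ b))
             (•-⊛ (f 0) (tail g) h j) (⊛-assoc (tail f) g h j) ⟩
  f 0 *ℤ g 0 *ℤ h (suc j) +ℤ (f 0 *ℤ (tail g ⊛ h) j +ℤ (tail f ⊛ (g ⊛ h)) j)
    ≡⟨ regroup (f 0) (g 0) (h (suc j)) ((tail g ⊛ h) j) ((tail f ⊛ (g ⊛ h)) j) ⟩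
  f 0 *ℤ (g 0 *ℤ h (suc j) +ℤ (tail g ⊛ h) j) +ℤ (tail f ⊛ (g ⊛ h)) j
    ≡⟨ cong (λ a → f 0 *ℤ a +ℤ (tail f ⊛ (g ⊛ h)) j) (sym (⊛-suc g h j)) ⟩
  f 0 *ℤ (g ⊛ h) (suc j) +ℤ (tail f ⊛ (g ⊛ h)) j
    ≡⟨ sym (⊛-suc f (g ⊛ h) j) ⟩
  (f ⊛ (g ⊛ h)) (suc j) ∎
  where
  open ≡-Reasoning
  regroup : ∀ a b c d e → a *ℤ b *ℤ c +ℤ (a *ℤ d +ℤ e) ≡ a *ℤ (b *ℤ c +ℤ d) +ℤ e
  regroup = solve-∀

⊛-identityˡ : ∀ f → cst 1ℤ ⊛ f ≈ f
⊛-identityˡ f zero    = ℤP.*-identityˡ (f 0)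
⊛-identityˡ f (suc j) = begin
  (cst 1ℤ ⊛ f) (suc j)                        ≡⟨ ⊛-suc (cst 1ℤ) f j ⟩
  1ℤ *ℤ f (suc j) +ℤ (tail (cst 1ℤ) ⊛ f) j    ≡⟨ cong₂ _+ℤ_ (ℤP.*-identityˡ (f (suc j)))
                                                         (sumTo-zero j (λ _ _ → refl)) ⟩
  f (suc j) +ℤ 0ℤ                             ≡⟨ ℤP.+-identityʳ (f (suc j)) ⟩
  f (suc j)                                   ∎
  where open ≡-Reasoning

zeros : Series
zeros _ = 0ℤ

series-isCommutativeRing : IsCommutativeRing _⊕_ _⊛_ ⊖_ zeros (cst 1ℤ)
series-isCommutativeRing = record
  { isRing = record
    { +-isAbelianGroup = Pointwise.isAbelianGroup ℤP.+-0-isAbelianGroup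
    ; *-cong           = ⊛-cong
    ; *-assoc          = ⊛-assoc
    ; *-identity       = Consequences.comm∧idˡ⇒id ⊛-comm {e = cst 1ℤ} ⊛-identityˡ
    ; distrib          = Consequences.comm∧distrˡ⇒distr ⊕-cong ⊛-comm ⊛-distribˡ-⊕
    }
  ; *-comm = ⊛-comm
  }

series-commutativeRing : CommutativeRing 0ℓ 0ℓ
series-commutativeRing = record { isCommutativeRing = series-isCommutativeRing }

open CommutativeRing series-commutativeRing using () renaming
  (setoid to series-setoid; refl to ≈-refl; sym to ≈-sym; trans to ≈-trans; -‿cong to ⊖-cong)

cst-+ : ∀ a b → cst (a +ℤ b) ≈ cst a ⊕ cst b
cst-+ a b zero    = refl
cst-+ a b (suc _) = refl

cst-* : ∀ a b → cst (a *ℤ b) ≈ cst a ⊛ cst b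
cst-* a b zero    = refl
cst-* a b (suc j) = sym (begin
  (cst a ⊛ cst b) (suc j)                   ≡⟨ ⊛-suc (cst a) (cst b) j ⟩
  a *ℤ 0ℤ +ℤ (tail (cst a) ⊛ cst b) j       ≡⟨ cong₂ _+ℤ_ (ℤP.*-zeroʳ a) (sumTo-zero j (λ _ _ → refl)) ⟩
  0ℤ                                        ∎)
  where open ≡-Reasoning

cst-neg : ∀ a → cst (- a) ≈ ⊖ cst a
cst-neg a zero    = refl
cst-neg a (suc _) = refl

cst-0 : cst 0ℤ ≈ zeros
cst-0 zero    = refl
cst-0 (suc _) = refl

cst-homomorphism : +-*-rawRing -Raw-AlmostCommutative⟶ fromCommutativeRing series-commutativeRing
cst-homomorphism = record
  { ⟦_⟧    = cst
  ; +-homo = cst-+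
  ; *-homo = cst-*
  ; -‿homo = cst-neg
  ; 0-homo = cst-0
  ; 1-homo = ≈-refl
  }

cst-≟ : ∀ a b → Maybe (cst a ≈ cst b)
cst-≟ a b with a ℤ.≟ b
... | yes refl = just ≈-refl
... | no _     = nothing

open RingSolver +-*-rawRing (fromCommutativeRing series-commutativeRing) cst-homomorphism cst-≟
  using (solve; _:=_; _:+_; _:*_; :-_; _:-_; con)

≈-modulo : ∀ {X Y L R} k → X ≈ Y ⊕ k ⊛ (L ⊕ ⊖ R) → L ≈ R → X ≈ Y
≈-modulo {X} {Y} {L} {R} k X≈ L≈R = begin
  X                  ≈⟨ X≈ ⟩
  Y ⊕ k ⊛ (L ⊕ ⊖ R)  ≈⟨ ⊕-congˡ Y (⊛-congˡ k (⊕-congʳ (⊖ R) L≈R)) ⟩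
  Y ⊕ k ⊛ (R ⊕ ⊖ R)  ≈⟨ solve 3 (λ y k r → y :+ k :* (r :- r) := y) ≈-refl Y k R ⟩
  Y                  ∎
  where open SetoidReasoning series-setoid

q : Series
q = qpow 1

qpow-zero : qpow 0 ≈ cst 1ℤ
qpow-zero zero    = refl
qpow-zero (suc _) = refl

qpow-suc-⊛ : ∀ k f j → (qpow (suc k) ⊛ f) (suc j) ≡ (qpow k ⊛ f) j
qpow-suc-⊛ k f j = trans (⊛-suc (qpow (suc k)) f j) (ℤP.+-identityˡ _)

q-⊛-suc : ∀ f j → (q ⊛ f) (suc j) ≡ f j
q-⊛-suc f j = trans (qpow-suc-⊛ 0 f j) (trans (⊛-congʳ f qpow-zero j) (⊛-identityˡ f j))

qpow-⊛-leading : ∀ k f → (qpow k ⊛ f) k ≡ f 0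
qpow-⊛-leading zero    f = ℤP.*-identityˡ (f 0)
qpow-⊛-leading (suc k) f = trans (qpow-suc-⊛ k f k) (qpow-⊛-leading k f)

qpow-+ : ∀ a b → qpow (a + b) ≈ qpow a ⊛ qpow b
qpow-+ zero    b j       = sym (trans (⊛-congʳ (qpow b) qpow-zero j) (⊛-identityˡ (qpow b) j))
qpow-+ (suc a) b zero    = refl
qpow-+ (suc a) b (suc j) = trans (qpow-+ a b j) (sym (qpow-suc-⊛ a (qpow b) j))

qpow-suc : ∀ k → qpow (suc k) ≈ q ⊛ qpow k
qpow-suc = qpow-+ 1

head+q⊛tail : ∀ {f c} → f 0 ≡ c → f ≈ cst c ⊕ q ⊛ tail f
head+q⊛tail {f} {c} f0≡c zero    = trans f0≡c (sym (ℤP.+-identityʳ c))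
head+q⊛tail {f} {c} f0≡c (suc j) = sym (trans (ℤP.+-identityˡ _) (q-⊛-suc (tail f) j))

qint-difference : ∀ a j → qint a (suc j) +ℤ - qint a j ≡ - qpow a (suc j)
qint-difference zero          j       = refl
qint-difference (suc zero)    zero    = refl
qint-difference (suc zero)    (suc j) = refl
qint-difference (suc (suc a)) zero    = refl
qint-difference (suc (suc a)) (suc j) = qint-difference (suc a) j

qint-telescope : ∀ a → qint a ⊕ ⊖ (q ⊛ qint a) ≈ cst 1ℤ ⊕ ⊖ qpow a
qint-telescope zero    zero    = refl
qint-telescope (suc a) zero    = refl
qint-telescope a       (suc j) = begin
  qint a (suc j) +ℤ - (q ⊛ qint a) (suc j)
    ≡⟨ cong (λ x → qint a (suc j) +ℤ - x) (q-⊛-suc (qint a) j) ⟩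
  qint a (suc j) +ℤ - qint a j
    ≡⟨ qint-difference a j ⟩
  - qpow a (suc j)
    ≡⟨ sym (ℤP.+-identityˡ _) ⟩
  0ℤ +ℤ - qpow a (suc j) ∎
  where open ≡-Reasoning

qint-⊛-1-q : ∀ a → qint a ⊛ (cst 1ℤ ⊕ ⊖ q) ≈ cst 1ℤ ⊕ ⊖ qpow a
qint-⊛-1-q a = ≈-trans (solve 2 (λ x t → x :* (con 1ℤ :- t) := x :- t :* x) ≈-refl (qint a) q)
                       (qint-telescope a)

-- q-adic divisibility and degree

infix 4 q^_∣_

q^_∣_ : ℕ → Series → Set
q^ K ∣ f = ∀ j → j < K → f j ≡ 0ℤ

q^∣-resp-≈ : ∀ {K f g} → f ≈ g → q^ K ∣ f → q^ K ∣ g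
q^∣-resp-≈ f≈g K∣f j j<K = trans (sym (f≈g j)) (K∣f j j<K)

q^0∣ : ∀ f → q^ 0 ∣ f
q^0∣ f j ()

q^∣-weaken : ∀ {K L f} → L ≤ K → q^ K ∣ f → q^ L ∣ f
q^∣-weaken L≤K K∣f j j<L = K∣f j (ℕP.<-≤-trans j<L L≤K)

q^∣-⊕ : ∀ {K f g} → q^ K ∣ f → q^ K ∣ g → q^ K ∣ f ⊕ g
q^∣-⊕ K∣f K∣g j j<K = cong₂ _+ℤ_ (K∣f j j<K) (K∣g j j<K)

q^∣-⊖ : ∀ {K f} → q^ K ∣ f → q^ K ∣ ⊖ f
q^∣-⊖ K∣f j j<K = cong -_ (K∣f j j<K)

q^∣-⊛ : ∀ {K L f g} → q^ K ∣ f → q^ L ∣ g → q^ (K + L) ∣ f ⊛ g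
q^∣-⊛ {zero} {f = f} _ L∣g j j<L = sumTo-zero j λ i _ →
  trans (cong (f i *ℤ_) (L∣g (j ∸ i) (ℕP.≤-<-trans (ℕP.m∸n≤m j i) j<L))) (ℤP.*-zeroʳ (f i))
q^∣-⊛ {suc K} {g = g} K∣f L∣g zero    _         = cong (_*ℤ g 0) (K∣f 0 z<s)
q^∣-⊛ {suc K} {f = f} {g} K∣f L∣g (suc j) (s≤s j<K+L) = trans (⊛-suc f g j)
  (cong₂ _+ℤ_ (cong (_*ℤ g (suc j)) (K∣f 0 z<s))
              (q^∣-⊛ (λ i i<K → K∣f (suc i) (s≤s i<K)) L∣g j j<K+L))

q^∣-⊛ʳ : ∀ {K g} f → q^ K ∣ g → q^ K ∣ f ⊛ g
q^∣-⊛ʳ f = q^∣-⊛ (q^0∣ f)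

q^∣-⊛ˡ : ∀ {K f} → q^ K ∣ f → ∀ g → q^ K ∣ f ⊛ g
q^∣-⊛ˡ {K} K∣f g = q^∣-weaken (ℕP.m≤m+n K 0) (q^∣-⊛ K∣f (q^0∣ g))

q^k∣qpow : ∀ k → q^ k ∣ qpow k
q^k∣qpow (suc k) zero    _         = refl
q^k∣qpow (suc k) (suc j) (s≤s j<k) = q^k∣qpow k j j<k

q∣q⊛ : ∀ f → q^ 1 ∣ q ⊛ f
q∣q⊛ f zero    _         = refl
q∣q⊛ f (suc j) (s≤s ())

q^∣-coefficient : ∀ {K j} f g → q^ K ∣ f ⊕ ⊖ g → j < K → f j ≡ g j
q^∣-coefficient {j = j} f g K∣f-g j<K = ℤP.i-j≡0⇒i≡j (f j) (g j) (K∣f-g j j<K)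

DegreeBelow : ℕ → Series → Set
DegreeBelow D f = ∀ j → D ≤ j → f j ≡ 0ℤ

degree-weaken : ∀ {D E f} → D ≤ E → DegreeBelow D f → DegreeBelow E f
degree-weaken D≤E deg j E≤j = deg j (ℕP.≤-trans D≤E E≤j)

degree-⊕ : ∀ {D f g} → DegreeBelow D f → DegreeBelow D g → DegreeBelow D (f ⊕ g)
degree-⊕ deg-f deg-g j D≤j = cong₂ _+ℤ_ (deg-f j D≤j) (deg-g j D≤j)

degree-⊖ : ∀ {D f} → DegreeBelow D f → DegreeBelow D (⊖ f)
degree-⊖ deg j D≤j = cong -_ (deg j D≤j)

degree-⊛ : ∀ {a b f g} → DegreeBelow (suc a) f → DegreeBelow (suc b) g →
           DegreeBelow (suc (a + b)) (f ⊛ g)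
degree-⊛ {a} {b} {f} {g} deg-f deg-g j a+b<j = sumTo-zero j term-zero
  where
  term-zero : ∀ i → i ≤ j → f i *ℤ g (j ∸ i) ≡ 0ℤ
  term-zero i i≤j with suc a ℕP.≤? i
  ... | yes a<i = cong (_*ℤ g (j ∸ i)) (deg-f i a<i)
  ... | no  a≮i = trans (cong (f i *ℤ_) (deg-g (j ∸ i) b<j∸i)) (ℤP.*-zeroʳ (f i))
    where
    b<j∸i : suc b ≤ j ∸ i
    b<j∸i = ℕP.≤-trans
      (ℕP.m+n≤o⇒m≤o∸n (suc b) (subst (_≤ j) (cong suc (ℕP.+-comm a b)) a+b<j))
      (ℕP.∸-monoʳ-≤ j (ℕP.≤-pred (ℕP.≰⇒> a≮i)))

degree-cst : ∀ c → DegreeBelow 1 (cst c)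
degree-cst c (suc _) _ = refl

degree-qpow : ∀ k → DegreeBelow (suc k) (qpow k)
degree-qpow zero    (suc j) _         = refl
degree-qpow (suc k) (suc j) (s≤s k<j) = degree-qpow k j k<j

degree-qint : ∀ a → DegreeBelow a (qint a)
degree-qint zero    j       _         = refl
degree-qint (suc a) (suc j) (s≤s a≤j) = degree-qint a j a≤j

angle-degree : ∀ n → DegreeBelow (2 + n) (angle n)
angle-degree n = degree-⊕
  (degree-⊛ {1} {n} (degree-qpow 1) (degree-weaken (ℕP.n≤1+n n) (degree-qint n)))
  (degree-weaken (s≤s (ℕP.≤-reflexive (ℕP.+-comm n 1)))
    (degree-⊛ {n} {1}
      (degree-⊕ (degree-weaken z<s (degree-cst 1ℤ)) (degree-qpow n))
      (degree-⊕ (degree-weaken (s≤s z≤n) (degree-cst 1ℤ)) (degree-⊖ (degree-qpow 1)))))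

-- Fractions and q-adic convergence

infix 4 _≋_

_≋_ : Frac → Frac → Set
F ≋ G = proj₁ F ≈ proj₁ G × proj₂ F ≈ proj₂ G

≋-refl : ∀ {F} → F ≋ F
≋-refl = ≈-refl , ≈-refl

≋-sym : ∀ {F G} → F ≋ G → G ≋ F
≋-sym (num≈ , den≈) = ≈-sym num≈ , ≈-sym den≈

≋-trans : ∀ {F G H} → F ≋ G → G ≋ H → F ≋ H
≋-trans (num≈ , den≈) (num≈′ , den≈′) = ≈-trans num≈ num≈′ , ≈-trans den≈ den≈′

+F-cong : ∀ {F F′ G G′} → F ≋ F′ → G ≋ G′ → F +F G ≋ F′ +F G′
+F-cong (p≈ , q≈) (r≈ , s≈) = ⊕-cong (⊛-cong p≈ s≈) (⊛-cong r≈ q≈) , ⊛-cong q≈ s≈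

/F-cong : ∀ {F F′ G G′} → F ≋ F′ → G ≋ G′ → F /F G ≋ F′ /F G′
/F-cong (p≈ , q≈) (r≈ , s≈) = ⊛-cong p≈ s≈ , ⊛-cong q≈ r≈

scale : ℕ → Frac → Frac
scale k (U , V) = qpow k ⊛ U , qpow k ⊛ V

scale-cong : ∀ k {F G} → F ≋ G → scale k F ≋ scale k G
scale-cong k (U≈ , V≈) = ⊛-congˡ (qpow k) U≈ , ⊛-congˡ (qpow k) V≈

scale-zero : ∀ F → scale 0 F ≋ F
scale-zero (U , V) = ≈-trans (⊛-congʳ U qpow-zero) (⊛-identityˡ U)
                   , ≈-trans (⊛-congʳ V qpow-zero) (⊛-identityˡ V)

scale-+ : ∀ j k F → scale j (scale k F) ≋ scale (j + k) F
scale-+ j k (U , V) =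
    ≈-trans (≈-sym (⊛-assoc (qpow j) (qpow k) U)) (⊛-congʳ U (≈-sym (qpow-+ j k)))
  , ≈-trans (≈-sym (⊛-assoc (qpow j) (qpow k) V)) (⊛-congʳ V (≈-sym (qpow-+ j k)))

residual : Frac → Series → Series
residual (U , V) h = U ⊕ ⊖ (V ⊛ h)

residual-cong : ∀ {F G} h → F ≋ G → residual F h ≈ residual G h
residual-cong h (U≈ , V≈) = ⊕-cong U≈ (⊖-cong (⊛-congʳ h V≈))

residual-scale : ∀ k F h → residual (scale k F) h ≈ qpow k ⊛ residual F h
residual-scale k (U , V) h =
  solve 4 (λ t u v x → t :* u :- t :* v :* x := t :* (u :- v :* x)) ≈-refl (qpow k) U V h

Approximates : ℕ → Frac → Series → Set
Approximates K (U , V) h = V 0 ≡ 1ℤ × q^ K ∣ residual (U , V) h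

-- The clause of Converges, with the order d of the denominator equal to k.
scaled-approximation : ∀ {F G h K} k → F ≋ scale k G → Approximates K G h →
    (∀ j → j < k → proj₂ F j ≡ 0ℤ)
  × ¬ (proj₂ F k ≡ 0ℤ)
  × (∀ j → j < K + k → residual F h j ≡ 0ℤ)
scaled-approximation {F} {G} {h} {K} k F≋ (V0≡1 , K∣res) =
    q^∣-resp-≈ (≈-sym (proj₂ F≋)) (q^∣-⊛ˡ (q^k∣qpow k) (proj₂ G))
  , (λ Fk≡0 → 1≢0 (trans (sym leading) Fk≡0))
  , λ j j<K+k → q^∣-resp-≈ (≈-sym (≈-trans (residual-cong h F≋) (residual-scale k G h)))
                          (q^∣-⊛ (q^k∣qpow k) K∣res) j (subst (j <_) (ℕP.+-comm K k) j<K+k)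
  where
  leading : proj₂ F k ≡ 1ℤ
  leading = trans (proj₂ F≋ k) (trans (qpow-⊛-leading k (proj₂ G)) V0≡1)

  1≢0 : ¬ (1ℤ ≡ 0ℤ)
  1≢0 ()

converges-if-approximated : ∀ {F h} →
  (∀ K → ∃[ M ] ∀ m → M ≤ m → ∃[ k ] ∃[ G ] (F m ≋ scale k G × Approximates K G h)) →
  Converges F h
converges-if-approximated {h = h} approx K =
  let M , close = approx K in
  M , λ m M≤m →
    let k , G , F≋ , G≈h = close m M≤m in
    k , scaled-approximation {G = G} {h} k F≋ G≈h

converges-if-approximated₀ : ∀ {F h} →
  (∀ K → ∃[ M ] ∀ m → M ≤ m → ∃[ G ] (F m ≋ G × Approximates K G h)) →
  Converges F h
converges-if-approximated₀ {h = h} approx = converges-if-approximated {h = h} λ K →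
  let M , close = approx K in
  M , λ m M≤m →
    let G , F≋ , G≈h = close m M≤m in
    0 , G , ≋-trans F≋ (≋-sym (scale-zero G)) , G≈h

-- q-adic fixed points

Contraction : (Series → Series) → Set
Contraction Φ = ∀ {K} a b → q^ K ∣ a ⊕ ⊖ b → q^ suc K ∣ Φ a ⊕ ⊖ Φ b

module _ {Φ : Series → Series} (contract : Contraction Φ) where

  private
    iterate : ℕ → Series
    iterate zero    = zeros
    iterate (suc k) = Φ (iterate k)

    iterate-step : ∀ k → q^ k ∣ iterate k ⊕ ⊖ iterate (suc k)
    iterate-step zero    = q^0∣ _
    iterate-step (suc k) = contract (iterate k) (iterate (suc k)) (iterate-step k)

    iterate-stable : ∀ d {i k} → i < k → iterate k i ≡ iterate (d + k) i
    iterate-stable zero    i<k = refl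
    iterate-stable (suc d) {k = k} i<k = trans (iterate-stable d i<k)
      (q^∣-coefficient (iterate (d + k)) (iterate (suc (d + k)))
                       (iterate-step (d + k)) (ℕP.≤-trans i<k (ℕP.m≤n+m k d)))

    limit : Series
    limit j = iterate (suc j) j

    limit-close : ∀ j → q^ suc j ∣ limit ⊕ ⊖ iterate (suc j)
    limit-close j i (s≤s i≤j) = ℤP.i≡j⇒i-j≡0 (trans (iterate-stable (j ∸ i) (ℕP.n<1+n i))
      (cong (λ k → iterate k i) (trans (ℕP.+-suc (j ∸ i) i) (cong suc (ℕP.m∸n+n≡m i≤j)))))

  contraction-fixedPoint : ∃[ s ] Φ s ≈ s
  contraction-fixedPoint = limit , λ j → trans
    (q^∣-coefficient (Φ limit) (iterate (suc (suc j)))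
                     (contract limit (iterate (suc j)) (limit-close j)) (ℕP.n≤1+n (suc j)))
    (sym (q^∣-coefficient (iterate (suc j)) (iterate (suc (suc j)))
                          (iterate-step (suc j)) (ℕP.n<1+n j)))

quadratic-root : ∀ {A W} → A 0 ≡ 1ℤ → q^ 1 ∣ W → ∀ p → ∃[ s ] A ⊛ s ⊕ W ⊛ s ⊛ s ≈ p
quadratic-root {A} {W} A0≡1 q∣W p =
  let s , Φs≈s = contraction-fixedPoint {Φ} Φ-contraction in
  s , ≈-modulo (cst 1ℤ)
        (solve 4 (λ a w p s → a :* s :+ w :* s :* s
                            := p :+ con 1ℤ :* (s :- (p :- (a :- con 1ℤ) :* s :- w :* s :* s)))
                 ≈-refl A W p s)
        (≈-sym Φs≈s)
  where
  Φ : Series → Series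
  Φ s = p ⊕ ⊖ ((A ⊕ ⊖ cst 1ℤ) ⊛ s) ⊕ ⊖ (W ⊛ s ⊛ s)

  q∣A-1 : q^ 1 ∣ A ⊕ ⊖ cst 1ℤ
  q∣A-1 zero    _        = ℤP.i≡j⇒i-j≡0 A0≡1
  q∣A-1 (suc j) (s≤s ())

  Φ-contraction : Contraction Φ
  Φ-contraction a b K∣a-b = q^∣-resp-≈
    (solve 5 (λ p a w x y →
        :- ((a :- con 1ℤ :+ w :* (x :+ y)) :* (x :- y))
        := (p :- (a :- con 1ℤ) :* x :- w :* x :* x) :- (p :- (a :- con 1ℤ) :* y :- w :* y :* y))
      ≈-refl p A W a b)
    (q^∣-⊖ (q^∣-⊛ (q^∣-⊕ q∣A-1 (q^∣-⊛ˡ q∣W (a ⊕ b))) K∣a-b))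

-- Periodic continued fractions

-- Numerator and denominator of A + B/(A + B/(⋯ + B/A)) with m fraction bars.
periodic : Series → Series → ℕ → Frac
periodic A B zero    = A , cst 1ℤ
periodic A B (suc m) = let U , V = periodic A B m in A ⊛ U ⊕ B ⊛ V , U

infixl 7 _÷_

_÷_ : Series → Frac → Frac
p ÷ (U , V) = p ⊛ V , U

gcfInner-periodic : ∀ {A B} c → (∀ i → den c (suc i) ≈ A) → (∀ i → num c (suc i) ≈ B) →
                    ∀ m i → gcfInner c (suc i) m ≋ periodic A B m
gcfInner-periodic c den≈ num≈ zero    i = den≈ i , ≈-refl
gcfInner-periodic {A} {B} c den≈ num≈ (suc m) i =
  ≋-trans
    (+F-cong (den≈ i , ≈-refl {cst 1ℤ})
             (/F-cong (num≈ i , ≈-refl {cst 1ℤ}) (gcfInner-periodic c den≈ num≈ m (suc i))))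
    ( solve 4 (λ a b u v → a :* (con 1ℤ :* u) :+ b :* v :* con 1ℤ := a :* u :+ b :* v) ≈-refl A B U V
    , solve 1 (λ u → con 1ℤ :* (con 1ℤ :* u) := u) ≈-refl U)
  where
  U V : Series
  U = proj₁ (periodic A B m)
  V = proj₂ (periodic A B m)

gcfTrunc-periodic : ∀ {A B} c → (∀ i → den c (suc i) ≈ A) → (∀ i → num c (suc i) ≈ B) →
                    ∀ m → gcfTrunc c m ≋ num c 0 ÷ periodic A B m
gcfTrunc-periodic c den≈ num≈ m =
  let U≈ , V≈ = gcfInner-periodic c den≈ num≈ m 0 in
  ⊛-congˡ (num c 0) V≈ , ≈-trans (⊛-identityˡ _) U≈

periodic-unit : ∀ {A B} → A 0 ≡ 1ℤ → B 0 ≡ 0ℤ → ∀ m → proj₁ (periodic A B m) 0 ≡ 1ℤ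
periodic-unit A0≡1 B0≡0 zero    = A0≡1
periodic-unit {A} {B} A0≡1 B0≡0 (suc m) =
  cong₂ _+ℤ_ (cong₂ _*ℤ_ A0≡1 (periodic-unit A0≡1 B0≡0 m))
              (cong (_*ℤ proj₂ (periodic A B m) 0) B0≡0)

periodic-residual : ∀ {A W p s} → A ⊛ s ⊕ W ⊛ s ⊛ s ≈ p → q^ 1 ∣ W →
                    ∀ m → q^ suc m ∣ residual (p ÷ periodic A (W ⊛ p) m) s
periodic-residual {A} {W} {p} {s} root q∣W zero = q^∣-resp-≈
  (≈-sym (≈-modulo (cst (- 1ℤ))
    (solve 4 (λ a w p s →
        p :* con 1ℤ :- a :* s := w :* s :* s :+ con (- 1ℤ) :* (a :* s :+ w :* s :* s :- p))
      ≈-refl A W p s)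
    root))
  (q^∣-⊛ˡ (q^∣-⊛ˡ q∣W s) s)
periodic-residual {A} {W} {p} {s} root q∣W (suc m) = q^∣-resp-≈
  (≈-sym (≈-modulo (⊖ U)
    (solve 6 (λ a w p s u v →
        p :* u :- (a :* u :+ w :* p :* v) :* s
        := :- (w :* s) :* (p :* v :- u :* s) :+ (:- u) :* (a :* s :+ w :* s :* s :- p))
      ≈-refl A W p s U V)
    root))
  (q^∣-⊛ (q^∣-⊖ (q^∣-⊛ˡ q∣W s)) (periodic-residual {A} {W} {p} {s} root q∣W m))
  where
  U V : Series
  U = proj₁ (periodic A (W ⊛ p) m)
  V = proj₂ (periodic A (W ⊛ p) m)

periodic-isSuperFraction : ∀ {δ k D} c →
  num c 0 ≈ qpow k → (∀ i → num c (suc i) ≈ qpow (k + k + δ)) → (∀ i → den c (suc i) ≈ D) →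
  D 0 ≡ 1ℤ → DegreeBelow (k + δ) D → IsSuperFraction δ c
periodic-isSuperFraction {δ} {k} {D} c num₀≈ num≈ den≈ D0≡1 deg =
    v , (λ _ → k) , (λ _ → tail D)
  , (λ { zero () ; (suc _) () })
  , ≈-trans num₀≈ (≈-sym (⊛-identityˡ (qpow k)))
  , (λ i → ≈-trans (num≈ i) (solve 1 (λ x → x := :- (con (- 1ℤ) :* x)) ≈-refl _))
  , (λ i → ≈-trans (den≈ i) (head+q⊛tail D0≡1))
  , λ _ j k+δ<j+2 → deg (suc j) (ℕP.≤-pred (subst (suc (k + δ) ≤_) (ℕP.+-comm j 2) k+δ<j+2))
  where
  v : ℕ → ℤ
  v zero    = 1ℤ
  v (suc _) = - 1ℤ

-- The metallic mean y_n

-- Powers of q are written through q and P = q^(n-1), so that the ring solver sees monomials in two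
-- atoms; A is ⟨n⟩_q and W is q^(n+2) in this form.
module MetallicMean (n′ : ℕ) where

  n : ℕ
  n = suc n′

  N P A W M : Series
  N = qint n
  P = qpow n′
  A = q ⊛ N ⊕ (cst 1ℤ ⊕ q ⊛ P) ⊛ (cst 1ℤ ⊕ ⊖ q)
  W = q ⊛ (q ⊛ (q ⊛ P))
  M = q ⊛ N ⊛ N ⊕ q ⊛ q ⊛ P ⊛ P

  qpow-n : qpow n ≈ q ⊛ P
  qpow-n = qpow-suc n′

  qpow-1+n : qpow (suc n) ≈ q ⊛ (q ⊛ P)
  qpow-1+n = ≈-trans (qpow-suc n) (⊛-congˡ q qpow-n)

  qpow-2n : qpow (n + n) ≈ q ⊛ (q ⊛ (P ⊛ P))
  qpow-2n = begin
    qpow (n + n)                ≡⟨ cong (qpow ∘ suc) (ℕP.+-suc n′ n′) ⟩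
    qpow (suc (suc (n′ + n′)))  ≈⟨ qpow-suc _ ⟩
    q ⊛ qpow (suc (n′ + n′))    ≈⟨ ⊛-congˡ q (qpow-suc _) ⟩
    q ⊛ (q ⊛ qpow (n′ + n′))    ≈⟨ ⊛-congˡ q (⊛-congˡ q (qpow-+ n′ n′)) ⟩
    q ⊛ (q ⊛ (P ⊛ P))           ∎
    where open SetoidReasoning series-setoid

  qpow-1+2n : qpow (suc (n + n)) ≈ W ⊛ P
  qpow-1+2n = ≈-trans (qpow-suc (n + n)) (≈-trans (⊛-congˡ q qpow-2n)
    (solve 2 (λ t p → t :* (t :* (t :* (p :* p))) := t :* (t :* (t :* p)) :* p) ≈-refl q P))

  angle≈A : angle n ≈ A
  angle≈A = ⊕-congˡ (q ⊛ N) (⊛-congʳ (cst 1ℤ ⊕ ⊖ q) (⊕-congˡ (cst 1ℤ) qpow-n))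

  σ-root : ∃[ s ] A ⊛ s ⊕ W ⊛ s ⊛ s ≈ P
  σ-root = quadratic-root {A} {W} refl (q∣q⊛ (q ⊛ (q ⊛ P))) P

  s y : Series
  s = proj₁ σ-root
  y = N ⊕ q ⊛ (q ⊛ P) ⊛ s

  y-expansion : y ≈ qint n ⊕ qpow (suc n) ⊛ s
  y-expansion = ⊕-congˡ N (⊛-congʳ s (≈-sym qpow-1+n))

  -- y = (M y + N)/(q N y + 1): y is the fixed point of step below.
  y-root : q ⊛ N ⊛ y ⊛ y ⊕ y ≈ M ⊛ y ⊕ N
  y-root = ≈-modulo k₂ (≈-modulo k₁ identity (proj₂ σ-root)) qint-relation
    where
    k₁ k₂ : Series
    k₁ = q ⊛ q ⊛ P ⊛ N
    k₂ = ⊖ (q ⊛ q ⊛ P ⊛ (cst 1ℤ ⊕ q ⊛ P) ⊛ s)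

    qint-relation : N ⊛ (cst 1ℤ ⊕ ⊖ q) ≈ cst 1ℤ ⊕ ⊖ (q ⊛ P)
    qint-relation = ≈-trans (qint-⊛-1-q n) (⊕-congˡ (cst 1ℤ) (⊖-cong qpow-n))

    identity : q ⊛ N ⊛ y ⊛ y ⊕ y
             ≈ M ⊛ y ⊕ N ⊕ k₂ ⊛ (N ⊛ (cst 1ℤ ⊕ ⊖ q) ⊕ ⊖ (cst 1ℤ ⊕ ⊖ (q ⊛ P)))
                         ⊕ k₁ ⊛ (A ⊛ s ⊕ W ⊛ s ⊛ s ⊕ ⊖ P)
    identity = solve 4 (λ t x p s →
      let y = x :+ t :* (t :* p) :* s
          m = t :* x :* x :+ t :* t :* p :* p
          a = t :* x :+ (con 1ℤ :+ t :* p) :* (con 1ℤ :- t)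
          w = t :* (t :* (t :* p))
      in  t :* x :* y :* y :+ y
       := m :* y :+ x
          :+ (:- (t :* t :* p :* (con 1ℤ :+ t :* p) :* s)) :* (x :* (con 1ℤ :- t) :- (con 1ℤ :- t :* p))
          :+ t :* t :* p :* x :* (a :* s :+ w :* s :* s :- p))
      ≈-refl q N P s

  step : Frac → Frac
  step (U , V) = M ⊛ U ⊕ N ⊛ V , q ⊛ N ⊛ U ⊕ V

  step-scaled : ∀ {F G} k → F ≋ scale k G → step F ≋ scale k (step G)
  step-scaled {G = U , V} k (U≈ , V≈) =
      ≈-trans (⊕-cong (⊛-congˡ M U≈) (⊛-congˡ N V≈))
              (solve 5 (λ m x t u v → m :* (t :* u) :+ x :* (t :* v) := t :* (m :* u :+ x :* v))
                     ≈-refl M N (qpow k) U V)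
    , ≈-trans (⊕-cong (⊛-congˡ (q ⊛ N) U≈) V≈)
              (solve 4 (λ r t u v → r :* (t :* u) :+ t :* v := t :* (r :* u :+ v))
                     ≈-refl (q ⊛ N) (qpow k) U V)

  Λ : Series
  Λ = N ⊛ N ⊕ q ⊛ P ⊛ P ⊕ ⊖ (N ⊛ y)

  step-residual : ∀ F → residual (step F) y ≈ q ⊛ Λ ⊛ residual F y
  step-residual (U , V) = ≈-modulo (⊖ V)
    (solve 6 (λ t x p y u v →
       let m = t :* x :* x :+ t :* t :* p :* p in
           m :* u :+ x :* v :- (t :* x :* u :+ v) :* y
        := t :* (x :* x :+ t :* p :* p :- x :* y) :* (u :- v :* y)
           :+ (:- v) :* (t :* x :* y :* y :+ y :- (m :* y :+ x)))
     ≈-refl q N P y U V)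
    y-root

  -- The truncations of [n, n, …]_q with the common power of q in numerator and denominator removed.
  normal : ℕ → Frac
  normal zero          = N , cst 1ℤ
  normal (suc zero)    = N ⊛ N ⊕ q ⊛ (P ⊛ P) , N
  normal (suc (suc m)) = step (normal m)

  normal-unit : ∀ m → proj₂ (normal m) 0 ≡ 1ℤ
  normal-unit zero          = refl
  normal-unit (suc zero)    = refl
  normal-unit (suc (suc m)) = trans (ℤP.+-identityˡ _) (normal-unit m)

  normal-residual : ∀ m → q^ ⌊ m /2⌋ ∣ residual (normal m) y
  normal-residual zero          = q^0∣ _
  normal-residual (suc zero)    = q^0∣ _
  normal-residual (suc (suc m)) =
    q^∣-resp-≈ (≈-sym (step-residual (normal m))) (q^∣-⊛ (q∣q⊛ Λ) (normal-residual m))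

  a : ℕ → ℕ
  a _ = n

  qcf-one-step : ∀ i → qcfFrom true a i 1 ≋ normal 1
  qcf-one-step i = ≋-trans
    (+F-cong (≋-refl {embed N}) (/F-cong (qpow-n , ≈-refl {cst 1ℤ}) (≋-refl {N , P})))
    ( solve 3 (λ t x p → x :* (con 1ℤ :* x) :+ t :* p :* p :* con 1ℤ := x :* x :+ t :* (p :* p))
              ≈-refl q N P
    , solve 1 (λ x → con 1ℤ :* (con 1ℤ :* x) := x) ≈-refl N)

  qcf-two-steps : ∀ m i →
    qcfFrom true a i (suc (suc m)) ≋ scale n′ (step (qcfFrom true a (suc (suc i)) m))
  qcf-two-steps m i = ≋-trans
    (+F-cong (≋-refl {embed N})
      (/F-cong (qpow-n , ≈-refl {cst 1ℤ})
        (+F-cong (≋-refl {N , P}) (/F-cong (≈-refl {cst 1ℤ} , qpow-n) (≋-refl {F})))))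
    ( solve 5 (λ t x p u v →
        x :* (con 1ℤ :* (x :* (t :* p :* u) :+ con 1ℤ :* v :* p))
          :+ t :* p :* (p :* (t :* p :* u)) :* con 1ℤ
        := p :* ((t :* x :* x :+ t :* t :* p :* p) :* u :+ x :* v))
        ≈-refl q N P U V
    , solve 5 (λ t x p u v →
        con 1ℤ :* (con 1ℤ :* (x :* (t :* p :* u) :+ con 1ℤ :* v :* p)) := p :* (t :* x :* u :+ v))
        ≈-refl q N P U V)
    where
    F : Frac
    F = qcfFrom true a (suc (suc i)) m
    U V : Series
    U = proj₁ F
    V = proj₂ F

  qcf-normal : ∀ m i → ∃[ k ] qcfFrom true a i m ≋ scale k (normal m)
  qcf-normal zero          i = 0 , ≋-sym (scale-zero (normal 0))
  qcf-normal (suc zero)    i = 0 , ≋-trans (qcf-one-step i) (≋-sym (scale-zero (normal 1)))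
  qcf-normal (suc (suc m)) i =
    let k , F≋ = qcf-normal m (suc (suc i)) in
    n′ + k , ≋-trans (qcf-two-steps m i)
                     (≋-trans (scale-cong n′ (step-scaled {G = normal m} k F≋))
                              (scale-+ n′ k (step (normal m))))

  qcf-converges : Converges (qcfTrunc a) y
  qcf-converges = converges-if-approximated {h = y} λ K → K + K , λ m 2K≤m →
    let k , F≋ = qcf-normal m 0 in
    k , normal m , F≋ , normal-unit m
      , q^∣-weaken (ℕP.≤-trans (ℕP.≤-reflexive (ℕP.n≡⌊n+n/2⌋ K)) (ℕP.⌊n/2⌋-mono 2K≤m))
                   (normal-residual m)

  convergent : ℕ → Frac
  convergent = periodic A (W ⊛ P)

  convergent-unit : ∀ m → proj₁ (convergent m) 0 ≡ 1ℤ
  convergent-unit = periodic-unit {A} {W ⊛ P} refl refl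

  convergent-residual : ∀ m → q^ suc m ∣ residual (P ÷ convergent m) s
  convergent-residual = periodic-residual {A} {W} {P} {s} (proj₂ σ-root) (q∣q⊛ (q ⊛ (q ⊛ P)))

  σ-converges : Converges (gcfTrunc (cfSigma n)) s
  σ-converges = converges-if-approximated₀ {h = s} λ K → K , λ m K≤m →
      P ÷ convergent m
    , gcfTrunc-periodic (cfSigma n) (λ _ → angle≈A) (λ _ → qpow-1+2n) m
    , convergent-unit m
    , q^∣-weaken (ℕP.m≤n⇒m≤1+n K≤m) (convergent-residual m)

  y-residual : ∀ F → residual (embed N +F qpow (n + n) ÷ F) y ≈ q ⊛ (q ⊛ P) ⊛ residual (P ÷ F) s
  y-residual (U , V) = ≈-modulo V
    (solve 7 (λ z x t p s u v →
        x :* u :+ z :* v :* con 1ℤ :- con 1ℤ :* u :* (x :+ t :* (t :* p) :* s)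
        := t :* (t :* p) :* (p :* v :- u :* s) :+ v :* (z :- t :* (t :* (p :* p))))
      ≈-refl (qpow (n + n)) N q P s U V)
    qpow-2n

  y-converges : Converges (λ m → embed N +F gcfTrunc (cfY n) m) y
  y-converges = converges-if-approximated₀ {h = y} λ K → K , λ m K≤m →
      embed N +F qpow (n + n) ÷ convergent m
    , +F-cong (≋-refl {embed N}) (gcfTrunc-periodic (cfY n) (λ _ → angle≈A) (λ _ → qpow-1+2n) m)
    , trans (ℤP.*-identityˡ _) (convergent-unit m)
    , q^∣-resp-≈ (≈-sym (y-residual (convergent m)))
                 (q^∣-⊛ʳ (q ⊛ (q ⊛ P))
                         (q^∣-weaken (ℕP.m≤n⇒m≤1+n K≤m) (convergent-residual m)))

  σ-isSuperFraction : IsSuperFraction 3 (cfSigma n)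
  σ-isSuperFraction = periodic-isSuperFraction (cfSigma n) ≈-refl
    (λ _ → cong-app (cong qpow exponent)) (λ _ → ≈-refl)
    refl (degree-weaken (ℕP.≤-reflexive (ℕP.+-comm 3 n′)) (angle-degree n))
    where
    exponent : suc (n + n) ≡ n′ + n′ + 3
    exponent = trans (cong (suc ∘ suc) (ℕP.+-suc n′ n′)) (ℕP.+-comm 3 (n′ + n′))

theorem3p2 : (n : ℕ) → 1 ≤ n →
  (∃[ g ] ( Converges (qcfTrunc (λ _ → n)) g
          × Converges (λ m → embed (qint n) +F gcfTrunc (cfY n) m) g
          × ∃[ s ] ( (g ≈ (qint n ⊕ qpow (suc n) ⊛ s))
                   × Converges (gcfTrunc (cfSigma n)) s )))
  × IsSuperFraction 3 (cfSigma n)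
theorem3p2 zero    ()
theorem3p2 (suc n′) _ =
  (y , qcf-converges , y-converges , s , y-expansion , σ-converges) , σ-isSuperFraction
  where open MetallicMean n′
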